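{- Let $d \equiv 2 \pmod 4$ be a square-free positive integer such that both equations $x^2 - dy^2 = -1$ and $x^2 - dy^2 = 6$ are solvable in integers. Then there exist infinitely many elements $n = (4m+2) + (4k+2)\sqrt{d}$ with $m, k \in \mathbb{Z}$ such that $n$ cannot be written as $\alpha^2 - \beta^2$ with $\alpha, \beta \in \mathbb{Z}[\sqrt{d}]$, while there exists a quadruple in $\mathbb{Z}[\sqrt{d}]$ with the property $D(n)$.
   Context: For a commutative ring $\mathcal{R}$ with unity and a nonzero $n \in \mathcal{R}$, a set $\{a_1, \dots, a_m\} \subset \mathcal{R} \setminus \{0\}$ of $m$ distinct elements has the property $D(n)$ if $a_i a_j + n$ is a perfect square in $\mathcal{R}$ for all $1 \le i < j \le m$; for $m=4$ it is called a quadruple with the property $D(n)$. -}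

module Defs where

open import Data.Nat as ℕ using (ℕ)
open import Data.Nat.Divisibility using (_∣_)
open import Data.Integer as ℤ using (ℤ; +_; -[1+_]; _+_; _*_; _-_)
open import Data.Product using (_×_; _,_; ∃-syntax)
open import Relation.Binary.PropositionalEquality using (_≡_; _≢_)
open import Data.List using (List)
open import Data.List.Membership.Propositional using (_∉_)

SquareFree : ℕ → Set
SquareFree d = ∀ (m : ℕ) → m ℕ.* m ∣ d → m ≡ 1

PellSolvable : ℕ → ℤ → Set
PellSolvable d c = ∃[ x ] ∃[ y ] (x * x - (+ d) * (y * y) ≡ c)

-- Elements of ℤ[√d]: the pair (a , b) represents a + b√d.
ZD : Set
ZD = ℤ × ℤ

module ZRing (d : ℕ) where
  infixl 6 _+D_ _-D_
  infixl 7 _*D_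

  0D : ZD
  0D = (+ 0 , + 0)

  _+D_ : ZD → ZD → ZD
  (a , b) +D (c , e) = (a + c , b + e)

  _-D_ : ZD → ZD → ZD
  (a , b) -D (c , e) = (a - c , b - e)

  _*D_ : ZD → ZD → ZD
  (a , b) *D (c , e) = (a * c + (+ d) * (b * e) , a * e + b * c)

  IsSquare : ZD → Set
  IsSquare y = ∃[ x ] (x *D x ≡ y)

  DiffOfSquares : ZD → Set
  DiffOfSquares n = ∃[ α ] ∃[ β ] (n ≡ α *D α -D β *D β)

  DQuadruple : ZD → ZD → ZD → ZD → ZD → Set
  DQuadruple n a₁ a₂ a₃ a₄ =
    (a₁ ≢ 0D × a₂ ≢ 0D × a₃ ≢ 0D × a₄ ≢ 0D) ×
    (a₁ ≢ a₂ × a₁ ≢ a₃ × a₁ ≢ a₄ × a₂ ≢ a₃ × a₂ ≢ a₄ × a₃ ≢ a₄) ×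
    (IsSquare (a₁ *D a₂ +D n) × IsSquare (a₁ *D a₃ +D n) × IsSquare (a₁ *D a₄ +D n) ×
     IsSquare (a₂ *D a₃ +D n) × IsSquare (a₂ *D a₄ +D n) × IsSquare (a₃ *D a₄ +D n))

  HasDQuadruple : ZD → Set
  HasDQuadruple n = ∃[ a₁ ] ∃[ a₂ ] ∃[ a₃ ] ∃[ a₄ ] DQuadruple n a₁ a₂ a₃ a₄

module Submission where

-- Let u = A + B√d be a unit of norm -1 with A ≡ 1 (mod 4) (it is ±(a + b√d)) and ξ an element of
-- norm 6; both exist by hypothesis, and the first one forces d ≡ 2 (mod 8).
--
-- The elements n = 2u are never differences of squares: if n = α² - β² = γ (γ + 2β), the norms P and Q
-- of the two factors satisfy Q ≡ P (mod 4) and P Q = N(n) = -4, so N(γ) = ±2 and N(γξ) = ±12; but then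
-- both coordinates of γξ are even, and ±3 is not a norm modulo 8 when d ≡ 2 (mod 8).
--
-- On the other hand {1, λ² - n, (λ + 1)² - n, (2λ + 1)² - 4n} has the property D(n) as soon as
-- (2λ + 1)² - 3n is a square v². Since 3n = 6u = ξ̄ ξ u, the choice 2λ + 1 = (ξ̄u + ξ)/2, v = (ξ̄u - ξ)/2
-- works; congruences modulo 4 show that the four elements are nonzero and distinct, except that
-- 1 = (2λ + 1)² - 4n would give n = v² - 1².
--
-- Multiplying n and the quadruple by the powers of the unit |a| + |b|√d keeps both properties and makes
-- the first coordinate of n arbitrarily large, so n avoids any given finite list.

open import Defs
open import Algebra.Bundles using (CommutativeRing)
open import Algebra.Structures using (IsCommutativeRing)
open import Algebra.Solver.Ring.AlmostCommutativeRing using (fromCommutativeRing; _-Raw-AlmostCommutative⟶_)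
import Algebra.Solver.Ring
open import Data.Empty using (⊥)
open import Data.Integer as ℤ using (ℤ; +_; -[1+_]; _+_; _*_; _-_; -_; ∣_∣)
open import Data.Integer.DivMod using (_%ℕ_; _/ℕ_; a≡a%ℕn+[a/ℕn]*n; n%ℕd<d)
import Data.Integer.Properties as ℤP
open import Data.Integer.Tactic.RingSolver using (solve-∀) renaming (solve to solveℤ)
open import Data.List using (List; []; _∷_)
open import Data.List.Membership.Propositional using (_∉_)
import Data.List.Relation.Unary.All as All
import Data.Maybe as Maybe
open import Data.Nat as ℕ using (ℕ; zero; suc; _%_; _/_; NonZero; >-nonZero)
open import Data.Nat.DivMod using (m≡m%n+[m/n]*n; m%n<n; m∣n⇒o%n%m≡o%m)
open import Data.Nat.Divisibility using (_∣_; divides; _∣?_)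
import Data.Nat.Properties as ℕP
open import Data.List.Extrema ℕP.≤-totalOrder using (argmax; f[xs]≤f[argmax])
open import Data.Product using (_×_; _,_; proj₁; proj₂; ∃-syntax)
open import Data.Sum using (_⊎_; inj₁; inj₂; [_,_]′)
open import Relation.Nullary using (¬_; contradiction)
open import Relation.Nullary.Decidable using (from-yes; from-no; ¬?; _×-dec_; _⊎-dec_; _→-dec_; dec⇒maybe)
open import Relation.Binary.PropositionalEquality
open ≡-Reasoning

-- Congruences of integers

infix 4 _≡_mod_
record _≡_mod_ (a b : ℤ) (m : ℕ) : Set where
  constructor ⟨_,_⟩
  field
    quotient : ℤ
    eq       : a ≡ b + quotient * + m
open _≡_mod_ public

module _ {m : ℕ} where
  private
    refl-identity : ∀ a m → a ≡ a + + 0 * m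
    refl-identity = solve-∀
    sym-identity : ∀ b k m → b ≡ (b + k * m) + - k * m
    sym-identity = solve-∀
    trans-identity : ∀ c k l m → (c + l * m) + k * m ≡ c + (k + l) * m
    trans-identity = solve-∀
    +-identity : ∀ b e k l m → (b + k * m) + (e + l * m) ≡ (b + e) + (k + l) * m
    +-identity = solve-∀
    *-identity : ∀ b e k l m → (b + k * m) * (e + l * m) ≡ b * e + (k * e + b * l + k * l * m) * m
    *-identity = solve-∀
    neg-identity : ∀ b k m → - (b + k * m) ≡ - b + - k * m
    neg-identity = solve-∀
    difference-identity : ∀ b k m → (b + k * m) - b ≡ k * m
    difference-identity = solve-∀
    divisor-identity : ∀ b k l m → b + k * (l * m) ≡ b + (k * l) * m
    divisor-identity = solve-∀

  ≡-mod-refl : ∀ {a} → a ≡ a mod m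
  ≡-mod-refl {a} = ⟨ + 0 , refl-identity a (+ m) ⟩

  ≡⇒≡-mod : ∀ {a b} → a ≡ b → a ≡ b mod m
  ≡⇒≡-mod refl = ≡-mod-refl

  ≡-mod-sym : ∀ {a b} → a ≡ b mod m → b ≡ a mod m
  ≡-mod-sym {b = b} ⟨ k , refl ⟩ = ⟨ - k , sym-identity b k (+ m) ⟩

  ≡-mod-trans : ∀ {a b c} → a ≡ b mod m → b ≡ c mod m → a ≡ c mod m
  ≡-mod-trans {c = c} ⟨ k , refl ⟩ ⟨ l , refl ⟩ = ⟨ k + l , trans-identity c k l (+ m) ⟩

  +-cong-mod : ∀ {a b c e} → a ≡ b mod m → c ≡ e mod m → a + c ≡ b + e mod m
  +-cong-mod {b = b} {e = e} ⟨ k , refl ⟩ ⟨ l , refl ⟩ = ⟨ k + l , +-identity b e k l (+ m) ⟩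

  *-cong-mod : ∀ {a b c e} → a ≡ b mod m → c ≡ e mod m → a * c ≡ b * e mod m
  *-cong-mod {b = b} {e = e} ⟨ k , refl ⟩ ⟨ l , refl ⟩ =
    ⟨ k * e + b * l + k * l * + m , *-identity b e k l (+ m) ⟩

  -‿cong-mod : ∀ {a b} → a ≡ b mod m → - a ≡ - b mod m
  -‿cong-mod {b = b} ⟨ k , refl ⟩ = ⟨ - k , neg-identity b k (+ m) ⟩

  ≡-mod⇒∣ : ∀ {a b} → a ≡ b mod m → m ∣ ∣ a - b ∣
  ≡-mod⇒∣ {b = b} ⟨ k , refl ⟩ =
    divides ∣ k ∣ (trans (cong ∣_∣ (difference-identity b k (+ m))) (ℤP.abs-* k (+ m)))

  ≡-mod-∣ : ∀ {n a b} → n ∣ m → a ≡ b mod m → a ≡ b mod n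
  ≡-mod-∣ {n} {b = b} (divides l refl) ⟨ k , refl ⟩ =
    ⟨ k * + l , trans (cong (λ z → b + k * z) (ℤP.pos-* l n)) (divisor-identity b k (+ l) (+ n)) ⟩

  ≢-mod : ∀ {a b r s} → a ≡ r mod m → b ≡ s mod m → ¬ (m ∣ ∣ r - s ∣) → a ≢ b
  ≢-mod a≡r b≡s m∤r-s refl = m∤r-s (≡-mod⇒∣ (≡-mod-trans (≡-mod-sym a≡r) b≡s))

  ≡-mod-shift : ∀ {r} x a → x - a ≡ r mod m → x ≡ a + r mod m
  ≡-mod-shift x a x-a≡r = ≡-mod-trans (≡⇒≡-mod (split x a)) (+-cong-mod (≡-mod-refl {a}) x-a≡r)
    where
    split : ∀ x a → x ≡ a + (x - a)
    split = solve-∀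

mz+r≡r : ∀ m z r → + m * z + r ≡ r mod m
mz+r≡r m z r = ⟨ z , identity (+ m) z r ⟩
  where
  identity : ∀ m z r → m * z + r ≡ r + z * m
  identity = solve-∀

module _ (m : ℕ) .{{_ : NonZero m}} where

  ≡-mod-%ℕ : ∀ a → a ≡ + (a %ℕ m) mod m
  ≡-mod-%ℕ a = ⟨ a /ℕ m , a≡a%ℕn+[a/ℕn]*n a m ⟩

  ≡-mod-% : ∀ n → + n ≡ + (n % m) mod m
  ≡-mod-% n = ⟨ + (n / m) , trans (cong +_ (m≡m%n+[m/n]*n n m))
    (trans (ℤP.pos-+ (n % m) (n / m ℕ.* m)) (cong (λ z → + (n % m) + z) (ℤP.pos-* (n / m) m))) ⟩

residue⇒≡-mod : ∀ {m k c} .{{_ : NonZero m}} .{{_ : NonZero k}} a → k ∣ m → (a %ℕ m) % k ≡ c → a ≡ + c mod k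
residue⇒≡-mod {m} {k} a k∣m r%k≡c =
  subst (λ c → a ≡ + c mod k) r%k≡c (≡-mod-trans (≡-mod-∣ k∣m (≡-mod-%ℕ m a)) (≡-mod-% k (a %ℕ m)))

even-or-odd : ∀ z → z ≡ + 0 mod 2 ⊎ z ≡ + 1 mod 2
even-or-odd z with z %ℕ 2 | n%ℕd<d z 2 | ≡-mod-%ℕ 2 z
... | 0           | _                    | z≡0 = inj₁ z≡0
... | 1           | _                    | z≡1 = inj₂ z≡1
... | suc (suc _) | ℕ.s≤s (ℕ.s≤s ()) | _

≡-mod-2-cases : ∀ x a → x ≡ a mod 2 ⊎ x ≡ a + + 1 mod 2
≡-mod-2-cases x a with even-or-odd (x - a)
... | inj₁ x-a≡0 = inj₁ (≡-mod-trans (≡-mod-shift x a x-a≡0) (≡⇒≡-mod (ℤP.+-identityʳ a)))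
... | inj₂ x-a≡1 = inj₂ (≡-mod-shift x a x-a≡1)

odd-mod-4⇒odd : ∀ {a} → a ≡ + 1 mod 4 ⊎ a ≡ + 3 mod 4 → a ≡ + 1 mod 2
odd-mod-4⇒odd (inj₁ a≡1) = ≡-mod-∣ (divides 2 refl) a≡1
odd-mod-4⇒odd (inj₂ a≡3) = ≡-mod-trans (≡-mod-∣ (divides 2 refl) a≡3) ⟨ + 1 , refl ⟩

odd⇒positive : ∀ {n} → + n ≡ + 1 mod 2 → 0 ℕ.< n
odd⇒positive {zero}  0≡1 = contradiction (≡-mod⇒∣ 0≡1) (from-no (2 ∣? 1))
odd⇒positive {suc n} _   = ℕ.s≤s ℕ.z≤n

twice-odd : ∀ {z} (z≡1 : z ≡ + 1 mod 2) → + 2 * z ≡ + 4 * quotient z≡1 + + 2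
twice-odd ⟨ h , refl ⟩ = identity h
  where
  identity : ∀ h → + 2 * (+ 1 + h * + 2) ≡ + 4 * h + + 2
  identity = solve-∀

∣z∣≡1⇒z≡±1 : ∀ {z} → ∣ z ∣ ≡ 1 → z ≡ + 1 ⊎ z ≡ - + 1
∣z∣≡1⇒z≡±1 {+ 1}           _ = inj₁ refl
∣z∣≡1⇒z≡±1 { -[1+ 0 ]}     _ = inj₂ refl
∣z∣≡1⇒z≡±1 {+ 0}           ()
∣z∣≡1⇒z≡±1 {+ suc (suc _)} ()
∣z∣≡1⇒z≡±1 { -[1+ suc _ ]} ()

+∣z∣*+∣z∣≡z*z : ∀ z → + ∣ z ∣ * + ∣ z ∣ ≡ z * z
+∣z∣*+∣z∣≡z*z (+ n)    = refl
+∣z∣*+∣z∣≡z*z -[1+ n ] = refl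

-- If P is odd then so is Q ≡ P (mod 4) and hence P Q; otherwise P = 2h and P Q = 4 h (h + 2k).
product≡-4⇒±2 : ∀ {P Q} → P * Q ≡ - + 4 → Q ≡ P mod 4 → P ≡ + 2 ⊎ P ≡ - + 2
product≡-4⇒±2 {P} PQ≡-4 Q≡P with even-or-odd P
... | inj₂ P≡1 = contradiction PQ≡-4
      (≢-mod (*-cong-mod P≡1 (≡-mod-trans (≡-mod-∣ (divides 2 refl) Q≡P) P≡1)) ≡-mod-refl (from-no (2 ∣? 5)))
... | inj₁ ⟨ h , refl ⟩ with Q≡P
...   | ⟨ k , refl ⟩ with ∣z∣≡1⇒z≡±1 {h} (ℕP.m*n≡1⇒m≡1 ∣ h ∣ ∣ h + k * + 2 ∣
                          (trans (sym (ℤP.abs-* h (h + k * + 2))) (cong ∣_∣ h[h+2k]≡-1)))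
  where
  product-identity : ∀ h k → (+ 0 + h * + 2) * ((+ 0 + h * + 2) + k * + 4) ≡ + 4 * (h * (h + k * + 2))
  product-identity = solve-∀
  h[h+2k]≡-1 : h * (h + k * + 2) ≡ - + 1
  h[h+2k]≡-1 = ℤP.*-cancelˡ-≡ (+ 4) _ _ (trans (sym (product-identity h k)) PQ≡-4)
...     | inj₁ refl = inj₁ refl
...     | inj₂ refl = inj₂ refl

growth-step : ∀ {a₀ b₀ d X Y} → 0 ℕ.< a₀ → 0 ℕ.< b₀ → 0 ℕ.< d → 0 ℕ.< Y →
              X ℕ.< a₀ ℕ.* X ℕ.+ d ℕ.* (b₀ ℕ.* Y) × 0 ℕ.< a₀ ℕ.* Y ℕ.+ b₀ ℕ.* X
growth-step {a₀} {b₀} {d} {X} {Y} 0<a₀ 0<b₀ 0<d 0<Y =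
  subst (ℕ._< a₀ ℕ.* X ℕ.+ d ℕ.* (b₀ ℕ.* Y)) (ℕP.+-identityʳ X)
    (ℕP.+-mono-≤-< (ℕP.m≤n*m X a₀ {{>-nonZero 0<a₀}}) (ℕP.*-mono-≤ 0<d (ℕP.*-mono-≤ 0<b₀ 0<Y))) ,
  ℕP.≤-trans (ℕP.*-mono-≤ 0<a₀ 0<Y) (ℕP.m≤m+n (a₀ ℕ.* Y) (b₀ ℕ.* X))

d%4≡2⇒0<d : ∀ d → d % 4 ≡ 2 → 0 ℕ.< d
d%4≡2⇒0<d (suc d) _ = ℕ.s≤s ℕ.z≤n

d%8≡2⇒d%4≡2 : ∀ d → d % 8 ≡ 2 → d % 4 ≡ 2
d%8≡2⇒d%4≡2 d d%8≡2 = trans (sym (m∣n⇒o%n%m≡o%m 4 8 d (divides 2 refl))) (cong (_% 4) d%8≡2)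

d≡8[d/8]+2 : ∀ d → d % 8 ≡ 2 → + d ≡ + 8 * + (d / 8) + + 2
d≡8[d/8]+2 d d%8≡2 = begin
  + d                          ≡⟨ eq (≡-mod-% 8 d) ⟩
  + (d % 8) + + (d / 8) * + 8  ≡⟨ cong (λ r → + r + + (d / 8) * + 8) d%8≡2 ⟩
  + 2 + + (d / 8) * + 8        ≡⟨ swap (+ 2) (+ (d / 8)) ⟩
  + 8 * + (d / 8) + + 2        ∎
  where
  swap : ∀ r q → r + q * + 8 ≡ + 8 * q + r
  swap = solve-∀

size : ZD → ℕ
size z = ∣ proj₁ z ∣

bound : List ZD → ℕ
bound L = size (argmax size (+ 0 , + 0) L)

∉-by-size : ∀ {z} L → bound L ℕ.< size z → z ∉ L
∉-by-size L bound<size z∈L =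
  ℕP.<⇒≱ bound<size (All.lookup (f[xs]≤f[argmax] {f = size} (+ 0 , + 0) L) z∈L)

-- The ring ℤ[√d]

norm : ℕ → ZD → ℤ
norm t (a , b) = a * a - + t * (b * b)

module ℤ[√d] (d : ℕ) where
  open ZRing d public

  1D : ZD
  1D = (+ 1 , + 0)

  negate : ZD → ZD
  negate (a , b) = (- a , - b)

  ι : ℤ → ZD
  ι z = (z , + 0)

  conj : ZD → ZD
  conj (a , b) = (a , - b)

  infixr 8 _^_
  _^_ : ZD → ℕ → ZD
  x ^ zero  = 1D
  x ^ suc j = x *D x ^ j

  Unit : ZD → Set
  Unit μ = ∃[ μ⁻¹ ] μ⁻¹ *D μ ≡ 1D

  Nonzero₄ : ZD → ZD → ZD → ZD → Set
  Nonzero₄ a₁ a₂ a₃ a₄ = a₁ ≢ 0D × a₂ ≢ 0D × a₃ ≢ 0D × a₄ ≢ 0D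

  Distinct₄ : ZD → ZD → ZD → ZD → Set
  Distinct₄ a₁ a₂ a₃ a₄ = a₁ ≢ a₂ × a₁ ≢ a₃ × a₁ ≢ a₄ × a₂ ≢ a₃ × a₂ ≢ a₄ × a₃ ≢ a₄

  SquareProducts : ZD → ZD → ZD → ZD → ZD → Set
  SquareProducts n a₁ a₂ a₃ a₄ =
    IsSquare (a₁ *D a₂ +D n) × IsSquare (a₁ *D a₃ +D n) × IsSquare (a₁ *D a₄ +D n) ×
    IsSquare (a₂ *D a₃ +D n) × IsSquare (a₂ *D a₄ +D n) × IsSquare (a₃ *D a₄ +D n)

  private
    *-assoc₁ : ∀ δ a b c e f g → (a * c + δ * (b * e)) * f + δ * ((a * e + b * c) * g)
                                 ≡ a * (c * f + δ * (e * g)) + δ * (b * (c * g + e * f))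
    *-assoc₁ = solve-∀
    *-assoc₂ : ∀ δ a b c e f g → (a * c + δ * (b * e)) * g + (a * e + b * c) * f
                                 ≡ a * (c * g + e * f) + b * (c * f + δ * (e * g))
    *-assoc₂ = solve-∀
    *-comm₁ : ∀ δ a b c e → a * c + δ * (b * e) ≡ c * a + δ * (e * b)
    *-comm₁ = solve-∀
    *-comm₂ : ∀ a b c e → a * e + b * c ≡ c * b + e * a
    *-comm₂ = solve-∀
    *-identityˡ₁ : ∀ δ a b → + 1 * a + δ * (+ 0 * b) ≡ a
    *-identityˡ₁ = solve-∀
    *-identityˡ₂ : ∀ a b → + 1 * b + + 0 * a ≡ b
    *-identityˡ₂ = solve-∀
    *-identityʳ₁ : ∀ δ a b → a * + 1 + δ * (b * + 0) ≡ a
    *-identityʳ₁ = solve-∀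
    *-identityʳ₂ : ∀ a b → a * + 0 + b * + 1 ≡ b
    *-identityʳ₂ = solve-∀
    distribˡ₁ : ∀ δ a b c e f g → a * (c + f) + δ * (b * (e + g)) ≡ (a * c + δ * (b * e)) + (a * f + δ * (b * g))
    distribˡ₁ = solve-∀
    distribˡ₂ : ∀ a b c e f g → a * (e + g) + b * (c + f) ≡ (a * e + b * c) + (a * g + b * f)
    distribˡ₂ = solve-∀
    distribʳ₁ : ∀ δ a b c e f g → (c + f) * a + δ * ((e + g) * b) ≡ (c * a + δ * (e * b)) + (f * a + δ * (g * b))
    distribʳ₁ = solve-∀
    distribʳ₂ : ∀ a b c e f g → (c + f) * b + (e + g) * a ≡ (c * b + e * a) + (f * b + g * a)
    distribʳ₂ = solve-∀

  isCommutativeRing : IsCommutativeRing _≡_ _+D_ _*D_ negate 0D 1D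
  isCommutativeRing = record
    { isRing = record
      { +-isAbelianGroup = record
        { isGroup = record
          { isMonoid = record
            { isSemigroup = record
              { isMagma = record { isEquivalence = isEquivalence ; ∙-cong = cong₂ _+D_ }
              ; assoc = λ { (a , b) (c , e) (f , g) → cong₂ _,_ (ℤP.+-assoc a c f) (ℤP.+-assoc b e g) } }
            ; identity = (λ { (a , b) → cong₂ _,_ (ℤP.+-identityˡ a) (ℤP.+-identityˡ b) })
                       , (λ { (a , b) → cong₂ _,_ (ℤP.+-identityʳ a) (ℤP.+-identityʳ b) }) }
          ; inverse = (λ { (a , b) → cong₂ _,_ (ℤP.+-inverseˡ a) (ℤP.+-inverseˡ b) })
                    , (λ { (a , b) → cong₂ _,_ (ℤP.+-inverseʳ a) (ℤP.+-inverseʳ b) })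
          ; ⁻¹-cong = cong negate }
        ; comm = λ { (a , b) (c , e) → cong₂ _,_ (ℤP.+-comm a c) (ℤP.+-comm b e) } }
      ; *-cong = cong₂ _*D_
      ; *-assoc = λ { (a , b) (c , e) (f , g) →
          cong₂ _,_ (*-assoc₁ (+ d) a b c e f g) (*-assoc₂ (+ d) a b c e f g) }
      ; *-identity = (λ { (a , b) → cong₂ _,_ (*-identityˡ₁ (+ d) a b) (*-identityˡ₂ a b) })
                   , (λ { (a , b) → cong₂ _,_ (*-identityʳ₁ (+ d) a b) (*-identityʳ₂ a b) })
      ; distrib = (λ { (a , b) (c , e) (f , g) →
                      cong₂ _,_ (distribˡ₁ (+ d) a b c e f g) (distribˡ₂ a b c e f g) })
                , (λ { (a , b) (c , e) (f , g) →
                      cong₂ _,_ (distribʳ₁ (+ d) a b c e f g) (distribʳ₂ a b c e f g) })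
      }
    ; *-comm = λ { (a , b) (c , e) → cong₂ _,_ (*-comm₁ (+ d) a b c e) (*-comm₂ a b c e) }
    }

  commutativeRing : CommutativeRing _ _
  commutativeRing = record { isCommutativeRing = isCommutativeRing }

  private
    ι-*₁ : ∀ δ a b → a * b ≡ a * b + δ * (+ 0 * + 0)
    ι-*₁ = solve-∀
    ι-*₂ : ∀ a b → + 0 ≡ a * + 0 + + 0 * b
    ι-*₂ = solve-∀

  ι-homomorphism : ℤ.+-*-rawRing -Raw-AlmostCommutative⟶ fromCommutativeRing commutativeRing
  ι-homomorphism = record
    { ⟦_⟧    = ι
    ; +-homo = λ a b → cong (a + b ,_) (ℤP.+-identityʳ (+ 0))
    ; *-homo = λ a b → cong₂ _,_ (ι-*₁ (+ d) a b) (ι-*₂ a b)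
    ; -‿homo = λ _ → refl
    ; 0-homo = refl
    ; 1-homo = refl
    }

  -- Coefficients are taken in ℤ: with ℤ[√d] itself as the coefficient ring, products of constants
  -- contain the stuck term + d * + 0 and the solver could not compare them.
  module Solver = Algebra.Solver.Ring ℤ.+-*-rawRing (fromCommutativeRing commutativeRing) ι-homomorphism
    (λ a b → Maybe.map (cong ι) (dec⇒maybe (a ℤP.≟ b)))
  open Solver using (solve; _:=_; _:+_; _:*_; _:-_; :-_; con)

  private
    ι-*D₁ : ∀ δ z a b → z * a + δ * (+ 0 * b) ≡ z * a
    ι-*D₁ = solve-∀
    ι-*D₂ : ∀ z a b → z * b + + 0 * a ≡ z * b
    ι-*D₂ = solve-∀
    conj-*D₁ : ∀ δ a b → a * a + δ * (- b * b) ≡ a * a - δ * (b * b)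
    conj-*D₁ = solve-∀
    conj-*D₂ : ∀ a b → a * b + - b * a ≡ + 0
    conj-*D₂ = solve-∀
    negate-conj-*D₁ : ∀ δ a b → - a * a + δ * (- - b * b) ≡ - (a * a - δ * (b * b))
    negate-conj-*D₁ = solve-∀
    negate-conj-*D₂ : ∀ a b → - a * b + - - b * a ≡ + 0
    negate-conj-*D₂ = solve-∀
    norm-*D-identity : ∀ δ a b c e → (a * c + δ * (b * e)) * (a * c + δ * (b * e)) - δ * ((a * e + b * c) * (a * e + b * c))
                                     ≡ (a * a - δ * (b * b)) * (c * c - δ * (e * e))
    norm-*D-identity = solve-∀
    norm-negate-identity : ∀ δ a b → - a * - a - δ * (- b * - b) ≡ a * a - δ * (b * b)
    norm-negate-identity = solve-∀
    norm-ι-identity : ∀ δ z → z * z - δ * (+ 0 * + 0) ≡ z * z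
    norm-ι-identity = solve-∀
    norm-+-twice-identity : ∀ δ a b p q → (a + + 2 * p) * (a + + 2 * p) - δ * ((b + + 2 * q) * (b + + 2 * q))
                                          ≡ (a * a - δ * (b * b)) + (a * p + p * p - δ * (b * q + q * q)) * + 4
    norm-+-twice-identity = solve-∀

  ι-*D : ∀ z a b → ι z *D (a , b) ≡ (z * a , z * b)
  ι-*D z a b = cong₂ _,_ (ι-*D₁ (+ d) z a b) (ι-*D₂ z a b)

  ι-*D-cancel : ∀ z {x y} .{{_ : ℤ.NonZero z}} → ι z *D x ≡ ι z *D y → x ≡ y
  ι-*D-cancel z {a , b} {a′ , b′} zx≡zy with trans (sym (ι-*D z a b)) (trans zx≡zy (ι-*D z a′ b′))
  ... | eq′ = cong₂ _,_ (ℤP.*-cancelˡ-≡ z a a′ (cong proj₁ eq′)) (ℤP.*-cancelˡ-≡ z b b′ (cong proj₂ eq′))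

  pos-*D : ∀ a b c e → (+ a , + b) *D (+ c , + e) ≡ (+ (a ℕ.* c ℕ.+ d ℕ.* (b ℕ.* e)) , + (a ℕ.* e ℕ.+ b ℕ.* c))
  pos-*D a b c e = sym (cong₂ _,_
    (trans (ℤP.pos-+ (a ℕ.* c) _) (cong₂ _+_ (ℤP.pos-* a c) (trans (ℤP.pos-* d _) (cong (λ z → + d * z) (ℤP.pos-* b e)))))
    (trans (ℤP.pos-+ (a ℕ.* e) _) (cong₂ _+_ (ℤP.pos-* a e) (ℤP.pos-* b c))))

  conj-*D-self : ∀ x → conj x *D x ≡ ι (norm d x)
  conj-*D-self (a , b) = cong₂ _,_ (conj-*D₁ (+ d) a b) (conj-*D₂ a b)

  norm-*D : ∀ x y → norm d (x *D y) ≡ norm d x * norm d y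
  norm-*D (a , b) (c , e) = norm-*D-identity (+ d) a b c e

  norm-negate : ∀ x → norm d (negate x) ≡ norm d x
  norm-negate (a , b) = norm-negate-identity (+ d) a b

  norm-ι : ∀ z → norm d (ι z) ≡ z * z
  norm-ι z = norm-ι-identity (+ d) z

  norm-+-twice : ∀ γ β → norm d (γ +D ι (+ 2) *D β) ≡ norm d γ mod 4
  norm-+-twice (a , b) (p , q) = subst (λ 2β → norm d ((a , b) +D 2β) ≡ norm d (a , b) mod 4) (sym (ι-*D (+ 2) p q))
    ⟨ a * p + p * p - + d * (b * q + q * q) , norm-+-twice-identity (+ d) a b p q ⟩

  norm-^-square : ∀ {x} → norm d x * norm d x ≡ + 1 → ∀ j → norm d (x ^ j) * norm d (x ^ j) ≡ + 1
  norm-^-square _ zero = cong (λ z → z * z) (norm-ι (+ 1))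
  norm-^-square {x} N² (suc j) = begin
    norm d (x *D x ^ j) * norm d (x *D x ^ j)                ≡⟨ cong (λ z → z * z) (norm-*D x (x ^ j)) ⟩
    (norm d x * norm d (x ^ j)) * (norm d x * norm d (x ^ j)) ≡⟨ regroup (norm d x) (norm d (x ^ j)) ⟩
    (norm d x * norm d x) * (norm d (x ^ j) * norm d (x ^ j)) ≡⟨ cong₂ _*_ N² (norm-^-square N² j) ⟩
    + 1                                                       ∎
    where
    regroup : ∀ a b → (a * b) * (a * b) ≡ (a * a) * (b * b)
    regroup = solve-∀

  norm≡-1⇒Unit : ∀ {x} → norm d x ≡ - + 1 → Unit x
  norm≡-1⇒Unit {a , b} N≡-1 =
    negate (conj (a , b)) , cong₂ _,_ (trans (negate-conj-*D₁ (+ d) a b) (cong -_ N≡-1)) (negate-conj-*D₂ a b)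

  Unit-*D : ∀ {x y} → Unit x → Unit y → Unit (x *D y)
  Unit-*D {x} {y} (x⁻¹ , x⁻¹x≡1) (y⁻¹ , y⁻¹y≡1) = y⁻¹ *D x⁻¹ , (begin
    (y⁻¹ *D x⁻¹) *D (x *D y)  ≡⟨ solve 4 (λ x y x⁻¹ y⁻¹ → (y⁻¹ :* x⁻¹) :* (x :* y) := (x⁻¹ :* x) :* (y⁻¹ :* y))
                                        refl x y x⁻¹ y⁻¹ ⟩
    (x⁻¹ *D x) *D (y⁻¹ *D y)  ≡⟨ cong₂ _*D_ x⁻¹x≡1 y⁻¹y≡1 ⟩
    1D *D 1D                  ≡⟨ solve 0 (con (+ 1) :* con (+ 1) := con (+ 1)) refl ⟩
    1D                        ∎)

  Unit-^ : ∀ {x} → Unit x → ∀ j → Unit (x ^ j)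
  Unit-^ _      zero    = 1D , solve 0 (con (+ 1) :* con (+ 1) := con (+ 1)) refl
  Unit-^ unit-x (suc j) = Unit-*D unit-x (Unit-^ unit-x j)

  difference-of-squares : ∀ α β → α *D α -D β *D β ≡ (α -D β) *D ((α -D β) +D ι (+ 2) *D β)
  difference-of-squares = solve 2 (λ α β → α :* α :- β :* β := (α :- β) :* ((α :- β) :+ con (+ 2) :* β)) refl

  square-from-halves : ∀ l v p q → ι (+ 4) *D l +D ι (+ 2) ≡ p +D q → ι (+ 2) *D v ≡ p -D q →
    v *D v ≡ (ι (+ 2) *D l +D 1D) *D (ι (+ 2) *D l +D 1D) -D p *D q
  square-from-halves l v p q sum≡ difference≡ = ι-*D-cancel (+ 4) (begin
    ι (+ 4) *D (v *D v)
      ≡⟨ solve 1 (λ v → con (+ 4) :* (v :* v) := (con (+ 2) :* v) :* (con (+ 2) :* v)) refl v ⟩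
    (ι (+ 2) *D v) *D (ι (+ 2) *D v)
      ≡⟨ cong (λ x → x *D x) difference≡ ⟩
    (p -D q) *D (p -D q)
      ≡⟨ solve 2 (λ p q → (p :- q) :* (p :- q) := (p :+ q) :* (p :+ q) :- con (+ 4) :* (p :* q)) refl p q ⟩
    (p +D q) *D (p +D q) -D ι (+ 4) *D (p *D q)
      ≡⟨ cong (λ s → s *D s -D ι (+ 4) *D (p *D q)) (sym sum≡) ⟩
    (ι (+ 4) *D l +D ι (+ 2)) *D (ι (+ 4) *D l +D ι (+ 2)) -D ι (+ 4) *D (p *D q)
      ≡⟨ solve 2 (λ l pq → let W = con (+ 2) :* l :+ con (+ 1) in
           (con (+ 4) :* l :+ con (+ 2)) :* (con (+ 4) :* l :+ con (+ 2)) :- con (+ 4) :* pq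
           := con (+ 4) :* (W :* W :- pq)) refl l (p *D q) ⟩
    ι (+ 4) *D ((ι (+ 2) *D l +D 1D) *D (ι (+ 2) *D l +D 1D) -D p *D q) ∎)

  module _ (l n : ZD) where
    private
      w : ZD
      w = ι (+ 2) *D l +D 1D

    quadruple-squares : ∀ {v} → v *D v ≡ w *D w -D ι (+ 3) *D n →
      SquareProducts n 1D (l *D l -D n) ((l +D 1D) *D (l +D 1D) -D n) (w *D w -D ι (+ 4) *D n)
    quadruple-squares {v} v²≡ =
      (l , solve 2 (λ l n → l :* l := con (+ 1) :* (l :* l :- n) :+ n) refl l n) ,
      (l +D 1D , solve 2 (λ l n → let l₁ = l :+ con (+ 1) in l₁ :* l₁ := con (+ 1) :* (l₁ :* l₁ :- n) :+ n) refl l n) ,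
      (v , trans v²≡ (solve 2 (λ l n → let W = con (+ 2) :* l :+ con (+ 1) in
             W :* W :- con (+ 3) :* n := con (+ 1) :* (W :* W :- con (+ 4) :* n) :+ n) refl l n)) ,
      (l *D l +D l -D n ,
        solve 2 (λ l n → let l₁ = l :+ con (+ 1) ; r = l :* l :+ l :- n in
          r :* r := (l :* l :- n) :* (l₁ :* l₁ :- n) :+ n) refl l n) ,
      (ι (+ 2) *D (l *D l) +D l -D ι (+ 2) *D n ,
        solve 2 (λ l n → let W = con (+ 2) :* l :+ con (+ 1) ; r = con (+ 2) :* (l :* l) :+ l :- con (+ 2) :* n in
          r :* r := (l :* l :- n) :* (W :* W :- con (+ 4) :* n) :+ n) refl l n) ,
      (ι (+ 2) *D (l *D l) +D ι (+ 3) *D l +D 1D -D ι (+ 2) *D n ,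
        solve 2 (λ l n → let l₁ = l :+ con (+ 1) ; W = con (+ 2) :* l :+ con (+ 1)
                             r = con (+ 2) :* (l :* l) :+ con (+ 3) :* l :+ con (+ 1) :- con (+ 2) :* n in
          r :* r := (l₁ :* l₁ :- n) :* (W :* W :- con (+ 4) :* n) :+ n) refl l n)

    first≢last : ∀ {v} → ¬ DiffOfSquares n → v *D v ≡ w *D w -D ι (+ 3) *D n → 1D ≢ w *D w -D ι (+ 4) *D n
    first≢last {v} ¬diff v²≡ 1≡last = ¬diff (v , 1D , sym (begin
      v *D v -D 1D *D 1D                          ≡⟨ cong (_-D 1D *D 1D) v²≡ ⟩
      w *D w -D ι (+ 3) *D n -D 1D *D 1D          ≡⟨ solve 2 (λ l n → let W = con (+ 2) :* l :+ con (+ 1) in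
                                                       W :* W :- con (+ 3) :* n :- con (+ 1) :* con (+ 1)
                                                       := (W :* W :- con (+ 4) :* n) :+ n :- con (+ 1) :* con (+ 1)) refl l n ⟩
      (w *D w -D ι (+ 4) *D n) +D n -D 1D *D 1D   ≡⟨ cong (λ a₄ → a₄ +D n -D 1D *D 1D) (sym 1≡last) ⟩
      1D +D n -D 1D *D 1D                         ≡⟨ solve 1 (λ n → con (+ 1) :+ n :- con (+ 1) :* con (+ 1) := n) refl n ⟩
      n                                           ∎))

  scale-DQuadruple : ∀ {μ n a₁ a₂ a₃ a₄} → Unit μ → DQuadruple n a₁ a₂ a₃ a₄ →
                     DQuadruple ((μ *D μ) *D n) (μ *D a₁) (μ *D a₂) (μ *D a₃) (μ *D a₄)
  scale-DQuadruple {μ} {n} (μ⁻¹ , inverse)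
    ((z₁ , z₂ , z₃ , z₄) , (d₁₂ , d₁₃ , d₁₄ , d₂₃ , d₂₄ , d₃₄) , (s₁₂ , s₁₃ , s₁₄ , s₂₃ , s₂₄ , s₃₄)) =
    (nonzero z₁ , nonzero z₂ , nonzero z₃ , nonzero z₄) ,
    (distinct d₁₂ , distinct d₁₃ , distinct d₁₄ , distinct d₂₃ , distinct d₂₄ , distinct d₃₄) ,
    (square s₁₂ , square s₁₃ , square s₁₄ , square s₂₃ , square s₂₄ , square s₃₄)
    where
    μ⁻¹μa≡a : ∀ a → μ⁻¹ *D (μ *D a) ≡ a
    μ⁻¹μa≡a a = begin
      μ⁻¹ *D (μ *D a)  ≡⟨ solve 3 (λ μ⁻¹ μ a → μ⁻¹ :* (μ :* a) := (μ⁻¹ :* μ) :* a) refl μ⁻¹ μ a ⟩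
      (μ⁻¹ *D μ) *D a  ≡⟨ cong (_*D a) inverse ⟩
      1D *D a          ≡⟨ solve 1 (λ a → con (+ 1) :* a := a) refl a ⟩
      a                ∎
    cancel : ∀ {a b} → μ *D a ≡ μ *D b → a ≡ b
    cancel {a} {b} μa≡μb = trans (sym (μ⁻¹μa≡a a)) (trans (cong (μ⁻¹ *D_) μa≡μb) (μ⁻¹μa≡a b))
    distinct : ∀ {a b} → a ≢ b → μ *D a ≢ μ *D b
    distinct a≢b μa≡μb = a≢b (cancel μa≡μb)
    nonzero : ∀ {a} → a ≢ 0D → μ *D a ≢ 0D
    nonzero a≢0 μa≡0 = a≢0 (cancel (trans μa≡0 (solve 1 (λ μ → con (+ 0) := μ :* con (+ 0)) refl μ)))
    square : ∀ {a b} → IsSquare (a *D b +D n) → IsSquare ((μ *D a) *D (μ *D b) +D (μ *D μ) *D n)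
    square {a} {b} (r , r²≡) = μ *D r , (begin
      (μ *D r) *D (μ *D r)                   ≡⟨ solve 2 (λ μ r → (μ :* r) :* (μ :* r) := (μ :* μ) :* (r :* r)) refl μ r ⟩
      (μ *D μ) *D (r *D r)                   ≡⟨ cong ((μ *D μ) *D_) r²≡ ⟩
      (μ *D μ) *D (a *D b +D n)              ≡⟨ solve 4 (λ μ a b n → (μ :* μ) :* (a :* b :+ n)
                                                   := (μ :* a) :* (μ :* b) :+ (μ :* μ) :* n) refl μ a b n ⟩
      (μ *D a) *D (μ *D b) +D (μ *D μ) *D n  ∎)

  scale-HasDQuadruple : ∀ {μ n} → Unit μ → HasDQuadruple n → HasDQuadruple ((μ *D μ) *D n)
  scale-HasDQuadruple {μ} unit (a₁ , a₂ , a₃ , a₄ , quadruple) =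
    μ *D a₁ , μ *D a₂ , μ *D a₃ , μ *D a₄ , scale-DQuadruple unit quadruple

  first-coordinate-grows : ∀ {a₀ b₀} → 0 ℕ.< a₀ → 0 ℕ.< b₀ → 0 ℕ.< d → ∀ j → let ε = (+ a₀ , + b₀) in
    ∃[ X ] ∃[ Y ] ((ε ^ j *D ε ^ j) *D ε ≡ (+ X , + Y) × j ℕ.< X × 0 ℕ.< Y)
  first-coordinate-grows {a₀} {b₀} 0<a₀ 0<b₀ 0<d zero =
    a₀ , b₀ , solve 1 (λ ε → (con (+ 1) :* con (+ 1)) :* ε := ε) refl (+ a₀ , + b₀) , 0<a₀ , 0<b₀
  first-coordinate-grows {a₀} {b₀} 0<a₀ 0<b₀ 0<d (suc j) with first-coordinate-grows 0<a₀ 0<b₀ 0<d j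
  ... | X , Y , W≡ , j<X , 0<Y =
    let X<X′ , 0<Y′ = growth-step {X = X} 0<a₀ 0<b₀ 0<d 0<Y
        X′<X″ , 0<Y″ = growth-step 0<a₀ 0<b₀ 0<d 0<Y′
    in _ , _ , (begin
      ((ε *D ε ^ j) *D (ε *D ε ^ j)) *D ε  ≡⟨ solve 2 (λ ε μ → ((ε :* μ) :* (ε :* μ)) :* ε := ε :* (ε :* ((μ :* μ) :* ε)))
                                                 refl ε (ε ^ j) ⟩
      ε *D (ε *D ((ε ^ j *D ε ^ j) *D ε))  ≡⟨ cong (λ w → ε *D (ε *D w)) W≡ ⟩
      ε *D (ε *D (+ X , + Y))              ≡⟨ cong (ε *D_) (pos-*D a₀ b₀ X Y) ⟩
      ε *D _                               ≡⟨ pos-*D a₀ b₀ _ _ ⟩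
      _                                    ∎) ,
      ℕP.≤-<-trans j<X (ℕP.<-trans X<X′ X′<X″) , 0<Y″
    where
    ε : ZD
    ε = (+ a₀ , + b₀)

  module _ (l m A b : ℤ) where
    private
      ℓ n w a₂ a₃ a₄ s : ZD
      ℓ  = (l , + 2 * m)
      n  = (+ 2 * A , + 2 * (+ 1 + b * + 2))
      w  = ι (+ 2) *D ℓ +D 1D
      a₂ = ℓ *D ℓ -D n
      a₃ = (ℓ +D 1D) *D (ℓ +D 1D) -D n
      a₄ = w *D w -D ι (+ 4) *D n
      s  = ℓ *D ℓ +D ℓ -D n

      ≢-by-fst : ∀ {m} {x y : ZD} {r s} → proj₁ x ≡ r mod m → proj₁ y ≡ s mod m → ¬ (m ∣ ∣ r - s ∣) → x ≢ y
      ≢-by-fst x≡r y≡s m∤r-s x≡y = ≢-mod x≡r y≡s m∤r-s (cong proj₁ x≡y)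
      ≢-by-snd : ∀ {m} {x y : ZD} {r s} → proj₂ x ≡ r mod m → proj₂ y ≡ s mod m → ¬ (m ∣ ∣ r - s ∣) → x ≢ y
      ≢-by-snd x≡r y≡s m∤r-s x≡y = ≢-mod x≡r y≡s m∤r-s (cong proj₂ x≡y)

      a₂₂ : l * (+ 2 * m) + + 2 * m * l - + 2 * (+ 1 + b * + 2) ≡ + 2 mod 4
      a₂₂ = ⟨ l * m - b - + 1 , solveℤ (l ∷ m ∷ b ∷ []) ⟩
      a₃₂ : (l + + 1) * (+ 2 * m + + 0) + (+ 2 * m + + 0) * (l + + 1) - + 2 * (+ 1 + b * + 2) ≡ + 2 mod 4
      a₃₂ = ⟨ l * m + m - b - + 1 , solveℤ (l ∷ m ∷ b ∷ []) ⟩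
      a₄≡4s+1 : a₄ ≡ (+ 4 * proj₁ s + + 1 , + 4 * proj₂ s + + 0)
      a₄≡4s+1 = trans (solve 2 (λ ℓ n → let W = con (+ 2) :* ℓ :+ con (+ 1) in
                         W :* W :- con (+ 4) :* n := con (+ 4) :* (ℓ :* ℓ :+ ℓ :- n) :+ con (+ 1)) refl ℓ n)
                      (cong (_+D 1D) (ι-*D (+ 4) (proj₁ s) (proj₂ s)))
      a₄₁ : proj₁ a₄ ≡ + 1 mod 4
      a₄₁ = ≡-mod-trans (≡⇒≡-mod (cong proj₁ a₄≡4s+1)) (mz+r≡r 4 (proj₁ s) (+ 1))
      a₄₂ : proj₂ a₄ ≡ + 0 mod 4
      a₄₂ = ≡-mod-trans (≡⇒≡-mod (cong proj₂ a₄≡4s+1)) (mz+r≡r 4 (proj₂ s) (+ 0))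
      a₃-a₂≡ : a₃ -D a₂ ≡ (+ 2 * l + + 1 , + 2 * (+ 2 * m) + + 0)
      a₃-a₂≡ = trans (solve 2 (λ ℓ n → let ℓ₁ = ℓ :+ con (+ 1) in
                        (ℓ₁ :* ℓ₁ :- n) :- (ℓ :* ℓ :- n) := con (+ 2) :* ℓ :+ con (+ 1)) refl ℓ n)
                     (cong (_+D 1D) (ι-*D (+ 2) l (+ 2 * m)))
      a₂≢a₃ : a₂ ≢ a₃
      a₂≢a₃ a₂≡a₃ = ≢-mod (mz+r≡r 2 l (+ 1)) ≡-mod-refl (from-no (2 ∣? 1))
        (cong proj₁ (trans (sym a₃-a₂≡) (trans (cong (a₃ -D_) a₂≡a₃) (solve 1 (λ a → a :- a := con (+ 0)) refl a₃))))

    -- Modulo 4 the second coordinates of a₂, a₃ are 2 and those of 1, a₄ are 0; a₄ and a₃ - a₂ have odd first coordinates.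
    quadruple-distinct : 1D ≢ a₄ → Nonzero₄ 1D a₂ a₃ a₄ × Distinct₄ 1D a₂ a₃ a₄
    quadruple-distinct 1≢a₄ =
      ((λ ()) , ≢-by-snd a₂₂ ≡-mod-refl ∤2 , ≢-by-snd a₃₂ ≡-mod-refl ∤2 , ≢-by-fst a₄₁ ≡-mod-refl ∤1) ,
      (≢-by-snd ≡-mod-refl a₂₂ ∤2 , ≢-by-snd ≡-mod-refl a₃₂ ∤2 , 1≢a₄ , a₂≢a₃ ,
       ≢-by-snd a₂₂ a₄₂ ∤2 , ≢-by-snd a₃₂ a₄₂ ∤2)
      where
      ∤1 = from-no (4 ∣? 1)
      ∤2 = from-no (4 ∣? 2)

-- Norms modulo 4 and 8

norm-≡-residues : ∀ d m .{{_ : NonZero m}} a b → norm d (a , b) ≡ norm (d % m) (+ (a %ℕ m) , + (b %ℕ m)) mod m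
norm-≡-residues d m a b =
  +-cong-mod (*-cong-mod (≡-mod-%ℕ m a) (≡-mod-%ℕ m a))
             (-‿cong-mod (*-cong-mod (≡-mod-% m d) (*-cong-mod (≡-mod-%ℕ m b) (≡-mod-%ℕ m b))))

norm-residues-∣ : ∀ d m .{{_ : NonZero m}} a b {c} → norm d (a , b) ≡ c mod m →
                  m ∣ ∣ norm (d % m) (+ (a %ℕ m) , + (b %ℕ m)) - c ∣
norm-residues-∣ d m a b N≡c = ≡-mod⇒∣ (≡-mod-trans (≡-mod-sym (norm-≡-residues d m a b)) N≡c)

-- Opaque: unfolding these exhaustive checks during unification is prohibitively expensive.
opaque
  norm≡-1⇒d%8≡2 : ∀ d a b → d % 4 ≡ 2 → norm d (a , b) ≡ - + 1 → d % 8 ≡ 2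
  norm≡-1⇒d%8≡2 d a b d%4≡2 N≡-1 =
    check (n%ℕd<d a 8) (n%ℕd<d b 8) (m%n<n d 8) (norm-residues-∣ d 8 a b (≡⇒≡-mod N≡-1))
          (trans (m∣n⇒o%n%m≡o%m 4 8 d (divides 2 refl)) d%4≡2)
    where
    check : ∀ {r} → r ℕ.< 8 → ∀ {s} → s ℕ.< 8 → ∀ {t} → t ℕ.< 8 →
            8 ∣ ∣ norm t (+ r , + s) - - + 1 ∣ → t % 4 ≡ 2 → t ≡ 2
    check = from-yes (ℕP.allUpTo? (λ r → ℕP.allUpTo? (λ s → ℕP.allUpTo? (λ t →
              (8 ∣? ∣ norm t (+ r , + s) - - + 1 ∣) →-dec ((t % 4 ℕP.≟ 2) →-dec (t ℕP.≟ 2))) 8) 8) 8)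

module _ (d : ℕ) where
  opaque
    norm≡-1⇒coordinates : ∀ a b → d % 4 ≡ 2 → norm d (a , b) ≡ - + 1 →
      (a ≡ + 1 mod 4 ⊎ a ≡ + 3 mod 4) × b ≡ + 1 mod 2
    norm≡-1⇒coordinates a b d%4≡2 N≡-1
      with check (n%ℕd<d a 4) (n%ℕd<d b 4)
             (subst (λ t → 4 ∣ ∣ norm t (+ (a %ℕ 4) , + (b %ℕ 4)) - - + 1 ∣) d%4≡2
               (norm-residues-∣ d 4 a b (≡⇒≡-mod N≡-1)))
      where
      check : ∀ {r} → r ℕ.< 4 → ∀ {s} → s ℕ.< 4 → 4 ∣ ∣ norm 2 (+ r , + s) - - + 1 ∣ →
              (r % 4 ≡ 1 ⊎ r % 4 ≡ 3) × s % 2 ≡ 1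
      check = from-yes (ℕP.allUpTo? (λ r → ℕP.allUpTo? (λ s →
                (4 ∣? ∣ norm 2 (+ r , + s) - - + 1 ∣) →-dec
                (((r % 4 ℕP.≟ 1) ⊎-dec (r % 4 ℕP.≟ 3)) ×-dec (s % 2 ℕP.≟ 1))) 4) 4)
    ... | inj₁ r≡1 , s≡1 = inj₁ (residue⇒≡-mod a (divides 1 refl) r≡1) , residue⇒≡-mod b (divides 2 refl) s≡1
    ... | inj₂ r≡3 , s≡1 = inj₂ (residue⇒≡-mod a (divides 1 refl) r≡3) , residue⇒≡-mod b (divides 2 refl) s≡1

    norm≡6⇒coordinates : ∀ x y → d % 8 ≡ 2 → norm d (x , y) ≡ + 6 → x ≡ + 0 mod 4 × y ≡ + 1 mod 2
    norm≡6⇒coordinates x y d%8≡2 N≡6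
      with check (n%ℕd<d x 8) (n%ℕd<d y 8)
             (subst (λ t → 8 ∣ ∣ norm t (+ (x %ℕ 8) , + (y %ℕ 8)) - + 6 ∣) d%8≡2
               (norm-residues-∣ d 8 x y (≡⇒≡-mod N≡6)))
      where
      check : ∀ {r} → r ℕ.< 8 → ∀ {s} → s ℕ.< 8 → 8 ∣ ∣ norm 2 (+ r , + s) - + 6 ∣ → r % 4 ≡ 0 × s % 2 ≡ 1
      check = from-yes (ℕP.allUpTo? (λ r → ℕP.allUpTo? (λ s →
                (8 ∣? ∣ norm 2 (+ r , + s) - + 6 ∣) →-dec ((r % 4 ℕP.≟ 0) ×-dec (s % 2 ℕP.≟ 1))) 8) 8)
    ... | r≡0 , s≡1 = residue⇒≡-mod x (divides 2 refl) r≡0 , residue⇒≡-mod y (divides 4 refl) s≡1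

    norm≡0[4]⇒even : ∀ x y {c} → d % 4 ≡ 2 → norm d (x , y) ≡ c → c ≡ + 0 mod 4 → x ≡ + 0 mod 2 × y ≡ + 0 mod 2
    norm≡0[4]⇒even x y d%4≡2 N≡c c≡0
      with check (n%ℕd<d x 4) (n%ℕd<d y 4)
             (subst (λ t → 4 ∣ ∣ norm t (+ (x %ℕ 4) , + (y %ℕ 4)) - + 0 ∣) d%4≡2
               (norm-residues-∣ d 4 x y (≡-mod-trans (≡⇒≡-mod N≡c) c≡0)))
      where
      check : ∀ {r} → r ℕ.< 4 → ∀ {s} → s ℕ.< 4 → 4 ∣ ∣ norm 2 (+ r , + s) - + 0 ∣ → r % 2 ≡ 0 × s % 2 ≡ 0
      check = from-yes (ℕP.allUpTo? (λ r → ℕP.allUpTo? (λ s →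
                (4 ∣? ∣ norm 2 (+ r , + s) - + 0 ∣) →-dec ((r % 2 ℕP.≟ 0) ×-dec (s % 2 ℕP.≟ 0))) 4) 4)
    ... | r≡0 , s≡0 = residue⇒≡-mod x (divides 2 refl) r≡0 , residue⇒≡-mod y (divides 2 refl) s≡0

    norm≢±3 : d % 8 ≡ 2 → ∀ x y → norm d (x , y) ≢ + 3 × norm d (x , y) ≢ - + 3
    norm≢±3 d%8≡2 x y = excluded (+ 3) (λ r<8 s<8 → proj₁ (check r<8 s<8)) , excluded (- + 3) (λ r<8 s<8 → proj₂ (check r<8 s<8))
      where
      check : ∀ {r} → r ℕ.< 8 → ∀ {s} → s ℕ.< 8 →
              ¬ (8 ∣ ∣ norm 2 (+ r , + s) - + 3 ∣) × ¬ (8 ∣ ∣ norm 2 (+ r , + s) - - + 3 ∣)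
      check = from-yes (ℕP.allUpTo? (λ r → ℕP.allUpTo? (λ s →
                ¬? (8 ∣? ∣ norm 2 (+ r , + s) - + 3 ∣) ×-dec ¬? (8 ∣? ∣ norm 2 (+ r , + s) - - + 3 ∣)) 8) 8)
      excluded : ∀ c → (∀ {r} → r ℕ.< 8 → ∀ {s} → s ℕ.< 8 → ¬ (8 ∣ ∣ norm 2 (+ r , + s) - c ∣)) → norm d (x , y) ≢ c
      excluded c ¬check N≡c = ¬check (n%ℕd<d x 8) (n%ℕd<d y 8)
        (subst (λ t → 8 ∣ ∣ norm t (+ (x %ℕ 8) , + (y %ℕ 8)) - c ∣) d%8≡2 (norm-residues-∣ d 8 x y (≡⇒≡-mod N≡c)))

-- Elements of norm -4 are not differences of squares

module _ (d : ℕ) where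
  open ℤ[√d] d

  private
    norm-of-doubles : ∀ δ k l → (+ 0 + k * + 2) * (+ 0 + k * + 2) - δ * ((+ 0 + l * + 2) * (+ 0 + l * + 2))
                                ≡ + 4 * (k * k - δ * (l * l))
    norm-of-doubles = solve-∀

  quarter-norm : d % 4 ≡ 2 → ∀ x y {c} → norm d (x , y) ≡ + 4 * c → ∃[ w ] norm d w ≡ c
  quarter-norm d%4≡2 x y {c} N≡4c
    with norm≡0[4]⇒even d x y d%4≡2 N≡4c ⟨ c , trans (ℤP.*-comm (+ 4) c) (sym (ℤP.+-identityˡ (c * + 4))) ⟩
  ... | ⟨ k , refl ⟩ , ⟨ l , refl ⟩ =
    (k , l) , ℤP.*-cancelˡ-≡ (+ 4) _ _ (trans (sym (norm-of-doubles (+ d) k l)) N≡4c)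

  norm≢±12 : d % 8 ≡ 2 → ∀ w → norm d w ≢ + 12 × norm d w ≢ - + 12
  norm≢±12 d%8≡2 (x , y) =
    (λ N≡12  → let (x′ , y′) , N′≡3  = quarter-norm d%4≡2 x y N≡12  in proj₁ (norm≢±3 d d%8≡2 x′ y′) N′≡3) ,
    (λ N≡-12 → let (x′ , y′) , N′≡-3 = quarter-norm d%4≡2 x y N≡-12 in proj₂ (norm≢±3 d d%8≡2 x′ y′) N′≡-3)
    where
    d%4≡2 = d%8≡2⇒d%4≡2 d d%8≡2

  norm≡-4⇒¬DiffOfSquares : d % 8 ≡ 2 → ∀ {ξ n} → norm d ξ ≡ + 6 → norm d n ≡ - + 4 → ¬ DiffOfSquares n
  norm≡-4⇒¬DiffOfSquares d%8≡2 {ξ} {n} N≡6 N≡-4 (α , β , n≡α²-β²) =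
    absurd (product≡-4⇒±2 norms≡-4 (norm-+-twice γ β))
    where
    γ : ZD
    γ = α -D β
    norms≡-4 : norm d γ * norm d (γ +D ι (+ 2) *D β) ≡ - + 4
    norms≡-4 = begin
      norm d γ * norm d (γ +D ι (+ 2) *D β)  ≡⟨ sym (norm-*D γ _) ⟩
      norm d (γ *D (γ +D ι (+ 2) *D β))      ≡⟨ cong (norm d) (sym (difference-of-squares α β)) ⟩
      norm d (α *D α -D β *D β)             ≡⟨ cong (norm d) (sym n≡α²-β²) ⟩
      norm d n                              ≡⟨ N≡-4 ⟩
      - + 4                                 ∎
    absurd : norm d γ ≡ + 2 ⊎ norm d γ ≡ - + 2 → ⊥
    absurd (inj₁ Nγ≡2)  = proj₁ (norm≢±12 d%8≡2 (γ *D ξ)) (trans (norm-*D γ ξ) (cong₂ _*_ Nγ≡2 N≡6))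
    absurd (inj₂ Nγ≡-2) = proj₂ (norm≢±12 d%8≡2 (γ *D ξ)) (trans (norm-*D γ ξ) (cong₂ _*_ Nγ≡-2 N≡6))

-- A D(2u)-quadruple

module _ (d : ℕ) where
  open ℤ[√d] d
  open Solver using (solve; _:=_; _:*_; con)

  module Witness (e a b t y : ℤ) (d≡8e+2 : + d ≡ + 8 * e + + 2) where
    x : ℤ
    x = a + t * + 2

    ξ u n : ZD
    ξ = (+ 0 + x * + 4 , + 1 + y * + 2)
    u = (+ 1 + a * + 4 , + 1 + b * + 2)
    n = (+ 2 * (+ 1 + a * + 4) , + 2 * (+ 1 + b * + 2))

    m : ℤ
    m = t + x * b - a * y

    -- ℓ = (ξ̄u + ξ - 2)/4 and v = (ξ̄u - ξ)/2; the second coordinate of ℓ is even because x ≡ a (mod 2).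
    ℓ v : ZD
    ℓ = (+ 2 * x * (+ 2 * a + + 1) - (+ 4 * e + + 1) * (+ 2 * y * b + y + b) - + 2 * e - + 1 , + 2 * m)
    v = (+ 8 * x * a - (+ 4 * e + + 1) * (+ 1 + y * + 2) * (+ 1 + b * + 2) ,
         + 2 * x * (+ 1 + b * + 2) - (+ 1 + y * + 2) * (+ 2 * a + + 1))

    private
      ℓ₁-identity : ∀ δ e a x y b → δ ≡ + 8 * e + + 2 →
        + 4 * (+ 2 * x * (+ 2 * a + + 1) - (+ 4 * e + + 1) * (+ 2 * y * b + y + b) - + 2 * e - + 1) + + 2
        ≡ (+ 0 + x * + 4) * (+ 1 + a * + 4) + δ * (- (+ 1 + y * + 2) * (+ 1 + b * + 2)) + (+ 0 + x * + 4)
      ℓ₁-identity _ e a x y b refl = solveℤ (e ∷ a ∷ x ∷ y ∷ b ∷ [])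
      ℓ₂-identity : ∀ a b t y →
        + 4 * (+ 2 * (t + (a + t * + 2) * b - a * y)) + + 0
        ≡ (+ 0 + (a + t * + 2) * + 4) * (+ 1 + b * + 2) + - (+ 1 + y * + 2) * (+ 1 + a * + 4) + (+ 1 + y * + 2)
      ℓ₂-identity = solve-∀
      v₁-identity : ∀ δ e a x y b → δ ≡ + 8 * e + + 2 →
        + 2 * (+ 8 * x * a - (+ 4 * e + + 1) * (+ 1 + y * + 2) * (+ 1 + b * + 2))
        ≡ (+ 0 + x * + 4) * (+ 1 + a * + 4) + δ * (- (+ 1 + y * + 2) * (+ 1 + b * + 2)) - (+ 0 + x * + 4)
      v₁-identity _ e a x y b refl = solveℤ (e ∷ a ∷ x ∷ y ∷ b ∷ [])
      v₂-identity : ∀ a x y b →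
        + 2 * (+ 2 * x * (+ 1 + b * + 2) - (+ 1 + y * + 2) * (+ 2 * a + + 1))
        ≡ (+ 0 + x * + 4) * (+ 1 + b * + 2) + - (+ 1 + y * + 2) * (+ 1 + a * + 4) - (+ 1 + y * + 2)
      v₂-identity = solve-∀

    ℓ-spec : ι (+ 4) *D ℓ +D ι (+ 2) ≡ conj ξ *D u +D ξ
    ℓ-spec = trans (cong (_+D ι (+ 2)) (ι-*D (+ 4) (proj₁ ℓ) (proj₂ ℓ)))
                   (cong₂ _,_ (ℓ₁-identity (+ d) e a x y b d≡8e+2) (ℓ₂-identity a b t y))

    v-spec : ι (+ 2) *D v ≡ conj ξ *D u -D ξ
    v-spec = trans (ι-*D (+ 2) (proj₁ v) (proj₂ v))
                   (cong₂ _,_ (v₁-identity (+ d) e a x y b d≡8e+2) (v₂-identity a x y b))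

    module _ (Nξ≡6 : norm d ξ ≡ + 6) where
      v² : v *D v ≡ (ι (+ 2) *D ℓ +D 1D) *D (ι (+ 2) *D ℓ +D 1D) -D ι (+ 3) *D n
      v² = trans (square-from-halves ℓ v (conj ξ *D u) ξ ℓ-spec v-spec)
        (cong ((ι (+ 2) *D ℓ +D 1D) *D (ι (+ 2) *D ℓ +D 1D) -D_) (begin
          (conj ξ *D u) *D ξ         ≡⟨ solve 3 (λ ξ̄ u ξ → (ξ̄ :* u) :* ξ := (ξ̄ :* ξ) :* u) refl (conj ξ) u ξ ⟩
          (conj ξ *D ξ) *D u         ≡⟨ cong (_*D u) (trans (conj-*D-self ξ) (cong ι Nξ≡6)) ⟩
          ι (+ 6) *D u               ≡⟨ solve 1 (λ u → con (+ 6) :* u := con (+ 3) :* (con (+ 2) :* u)) refl u ⟩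
          ι (+ 3) *D (ι (+ 2) *D u)  ≡⟨ cong (ι (+ 3) *D_) (ι-*D (+ 2) (proj₁ u) (proj₂ u)) ⟩
          ι (+ 3) *D n              ∎))

      quadruple : ¬ DiffOfSquares n → HasDQuadruple n
      quadruple ¬diff =
        let nonzero , distinct = quadruple-distinct (proj₁ ℓ) m (+ 1 + a * + 4) b (first≢last ℓ n {v} ¬diff v²)
        in _ , _ , _ , _ , nonzero , distinct , quadruple-squares ℓ n {v} v²

  -- Multiplying ξ by u², of norm 1, flips the parity of x, so that Witness applies to ξ or to ξu².
  parity-flip : ∀ {e a b x y} → + d ≡ + 8 * e + + 2 → x ≡ a + + 1 mod 2 →
    let ξ = (+ 0 + x * + 4 , + 1 + y * + 2) ; u = (+ 1 + a * + 4 , + 1 + b * + 2) in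
    ∃[ x″ ] proj₁ (ξ *D (u *D u)) ≡ + 0 + x″ * + 4 × (x″ ≡ a mod 2)
  parity-flip {e} {a} {b} {x} {y} d≡8e+2 x≡a+1 = x″ , fst-identity (+ d) e x A B Y d≡8e+2 , x″≡a
    where
    A B Y x″ : ℤ
    A  = + 1 + a * + 4
    B  = + 1 + b * + 2
    Y  = + 1 + y * + 2
    x″ = x * (A * A + + d * (B * B)) + (+ 4 * e + + 1) * (Y * (A * B))
    fst-identity : ∀ δ e x A B Y → δ ≡ + 8 * e + + 2 →
      (+ 0 + x * + 4) * (A * A + δ * (B * B)) + δ * (Y * (A * B + B * A))
      ≡ + 0 + (x * (A * A + δ * (B * B)) + (+ 4 * e + + 1) * (Y * (A * B))) * + 4
    fst-identity _ e x A B Y refl = solveℤ (e ∷ x ∷ A ∷ B ∷ Y ∷ [])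
    d≡0 : + d ≡ + 0 mod 2
    d≡0 = ⟨ + 4 * e + + 1 , trans d≡8e+2 (solveℤ (e ∷ [])) ⟩
    A≡1 : A ≡ + 1 mod 2
    A≡1 = ≡-mod-∣ (divides 2 refl) ⟨ a , refl ⟩
    B≡1 : B ≡ + 1 mod 2
    B≡1 = ⟨ b , refl ⟩
    Y≡1 : Y ≡ + 1 mod 2
    Y≡1 = ⟨ y , refl ⟩
    4e+1≡1 : + 4 * e + + 1 ≡ + 1 mod 2
    4e+1≡1 = ≡-mod-∣ (divides 2 refl) (mz+r≡r 4 e (+ 1))
    x″≡a : x″ ≡ a mod 2
    x″≡a = ≡-mod-trans
      (+-cong-mod (*-cong-mod x≡a+1 (+-cong-mod (*-cong-mod A≡1 A≡1) (*-cong-mod d≡0 (*-cong-mod B≡1 B≡1))))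
                  (*-cong-mod 4e+1≡1 (*-cong-mod Y≡1 (*-cong-mod A≡1 B≡1))))
      ⟨ + 1 , residue-identity a ⟩
      where
      residue-identity : ∀ a → (a + + 1) * (+ 1 * + 1 + + 0 * (+ 1 * + 1)) + + 1 * (+ 1 * (+ 1 * + 1)) ≡ a + + 1 * + 2
      residue-identity = solve-∀

  twice-unit-has-DQuadruple : d % 8 ≡ 2 → ∀ ξ u → norm d ξ ≡ + 6 → norm d u ≡ - + 1 → proj₁ u ≡ + 1 mod 4 →
    ¬ DiffOfSquares (ι (+ 2) *D u) → HasDQuadruple (ι (+ 2) *D u)
  twice-unit-has-DQuadruple d%8≡2 (X , Y) (A , B) Nξ≡6 Nu≡-1 ⟨ a , refl ⟩ ¬diff
    with norm≡6⇒coordinates d X Y d%8≡2 Nξ≡6 | proj₂ (norm≡-1⇒coordinates d A B (d%8≡2⇒d%4≡2 d d%8≡2) Nu≡-1)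
  ... | ⟨ x , refl ⟩ , ⟨ y , refl ⟩ | ⟨ b , refl ⟩ =
    subst HasDQuadruple (sym 2u≡n) (with-parity (≡-mod-2-cases x a))
    where
    e : ℤ
    e = + (d / 8)
    d≡8e+2 : + d ≡ + 8 * e + + 2
    d≡8e+2 = d≡8[d/8]+2 d d%8≡2
    n : ZD
    n = (+ 2 * (+ 1 + a * + 4) , + 2 * (+ 1 + b * + 2))
    2u≡n : ι (+ 2) *D (+ 1 + a * + 4 , + 1 + b * + 2) ≡ n
    2u≡n = ι-*D (+ 2) _ _
    ¬diff′ : ¬ DiffOfSquares n
    ¬diff′ = subst (λ n → ¬ DiffOfSquares n) 2u≡n ¬diff
    ξ u ξ′ : ZD
    ξ  = (+ 0 + x * + 4 , + 1 + y * + 2)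
    u  = (+ 1 + a * + 4 , + 1 + b * + 2)
    ξ′ = ξ *D (u *D u)
    Nξ′≡6 : norm d ξ′ ≡ + 6
    Nξ′≡6 = trans (norm-*D ξ (u *D u)) (cong₂ _*_ Nξ≡6 (trans (norm-*D u u) (cong₂ _*_ Nu≡-1 Nu≡-1)))
    with-parity : x ≡ a mod 2 ⊎ x ≡ a + + 1 mod 2 → HasDQuadruple n
    with-parity (inj₁ ⟨ t , x≡ ⟩) =
      Witness.quadruple e a b t y d≡8e+2 (subst (λ z → norm d (+ 0 + z * + 4 , + 1 + y * + 2) ≡ + 6) x≡ Nξ≡6) ¬diff′
    with-parity (inj₂ x≡a+1) =
      let x″ , X′≡ , ⟨ t , x″≡ ⟩ = parity-flip {e} {a} {b} {x} {y} d≡8e+2 x≡a+1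
          _ , ⟨ y″ , Y″≡ ⟩ = norm≡6⇒coordinates d (proj₁ ξ′) (proj₂ ξ′) d%8≡2 Nξ′≡6
          ξ′≡ = cong₂ _,_ (trans X′≡ (cong (λ z → + 0 + z * + 4) x″≡)) Y″≡
      in Witness.quadruple e a b t y″ d≡8e+2 (trans (cong (norm d) (sym ξ′≡)) Nξ′≡6) ¬diff′

-- The infinite family

module _ (d : ℕ) where
  open ℤ[√d] d

  normalised-sign : ∀ a₀ b₀ → d % 4 ≡ 2 → norm d (+ a₀ , + b₀) ≡ - + 1 →
    ∃[ u ] (u ≡ (+ a₀ , + b₀) ⊎ u ≡ negate (+ a₀ , + b₀)) × proj₁ u ≡ + 1 mod 4
  normalised-sign a₀ b₀ d%4≡2 Nε≡-1 with proj₁ (norm≡-1⇒coordinates d (+ a₀) (+ b₀) d%4≡2 Nε≡-1)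
  ... | inj₁ a₀≡1 = _ , inj₁ refl , a₀≡1
  ... | inj₂ a₀≡3 = _ , inj₂ refl , ≡-mod-trans (-‿cong-mod a₀≡3) ⟨ - + 1 , refl ⟩

module Family (d : ℕ) (d%8≡2 : d % 8 ≡ 2) {a₀ b₀ : ℕ} (Nε≡-1 : norm d (+ a₀ , + b₀) ≡ - + 1)
              {ξ : ZD} (Nξ≡6 : norm d ξ ≡ + 6)
              {u : ZD} (u≡±ε : u ≡ (+ a₀ , + b₀) ⊎ u ≡ ℤ[√d].negate d (+ a₀ , + b₀)) (u₁≡1 : proj₁ u ≡ + 1 mod 4) where
  open ℤ[√d] d
  open Solver using (solve; _:=_; _:*_; :-_; con)

  ε : ZD
  ε = (+ a₀ , + b₀)

  μ n w : ℕ → ZD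
  μ j = ε ^ j
  n j = (μ j *D μ j) *D (ι (+ 2) *D u)
  w j = (μ j *D μ j) *D u

  private
    d%4≡2 : d % 4 ≡ 2
    d%4≡2 = d%8≡2⇒d%4≡2 d d%8≡2
    ε-coordinates = norm≡-1⇒coordinates d (+ a₀) (+ b₀) d%4≡2 Nε≡-1

  Nu≡-1 : norm d u ≡ - + 1
  Nu≡-1 = [ (λ u≡ε → trans (cong (norm d) u≡ε) Nε≡-1) ,
            (λ u≡-ε → trans (cong (norm d) u≡-ε) (trans (norm-negate ε) Nε≡-1)) ]′ u≡±ε

  Nμ²≡1 : ∀ j → norm d (μ j *D μ j) ≡ + 1
  Nμ²≡1 j = trans (norm-*D (μ j) (μ j)) (norm-^-square (cong₂ _*_ Nε≡-1 Nε≡-1) j)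

  Nn≡-4 : ∀ j → norm d (n j) ≡ - + 4
  Nn≡-4 j = begin
    norm d (n j)                                ≡⟨ norm-*D (μ j *D μ j) (ι (+ 2) *D u) ⟩
    norm d (μ j *D μ j) * norm d (ι (+ 2) *D u)  ≡⟨ cong₂ _*_ (Nμ²≡1 j) (norm-*D (ι (+ 2)) u) ⟩
    + 1 * (norm d (ι (+ 2)) * norm d u)          ≡⟨ cong (λ z → + 1 * (z * norm d u)) (norm-ι (+ 2)) ⟩
    + 1 * (+ 4 * norm d u)                       ≡⟨ cong (λ z → + 1 * (+ 4 * z)) Nu≡-1 ⟩
    - + 4                                        ∎

  n-not-difference-of-squares : ∀ j → ¬ DiffOfSquares (n j)
  n-not-difference-of-squares j = norm≡-4⇒¬DiffOfSquares d d%8≡2 {ξ} {n j} Nξ≡6 (Nn≡-4 j)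

  n-has-DQuadruple : ∀ j → HasDQuadruple (n j)
  n-has-DQuadruple j = scale-HasDQuadruple (Unit-^ (norm≡-1⇒Unit Nε≡-1) j)
    (twice-unit-has-DQuadruple d d%8≡2 ξ u Nξ≡6 Nu≡-1 u₁≡1
      (subst (λ n → ¬ DiffOfSquares n) (solve 1 (λ n → (con (+ 1) :* con (+ 1)) :* n := n) refl (ι (+ 2) *D u))
             (n-not-difference-of-squares 0)))

  w-grows : ∀ j → j ℕ.< ∣ proj₁ (w j) ∣
  w-grows j =
    let X , _ , μ²ε≡ , j<X , _ = first-coordinate-grows (odd⇒positive (odd-mod-4⇒odd (proj₁ ε-coordinates)))
                                   (odd⇒positive (proj₂ ε-coordinates)) (d%4≡2⇒0<d d d%4≡2) j
    in subst (j ℕ.<_) (sym (trans (size≡ u≡±ε) (cong (λ z → ∣ proj₁ z ∣) μ²ε≡))) j<X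
    where
    size≡ : u ≡ ε ⊎ u ≡ negate ε → ∣ proj₁ (w j) ∣ ≡ ∣ proj₁ ((μ j *D μ j) *D ε) ∣
    size≡ (inj₁ u≡ε)  = cong (λ v → ∣ proj₁ ((μ j *D μ j) *D v) ∣) u≡ε
    size≡ (inj₂ u≡-ε) = begin
      ∣ proj₁ ((μ j *D μ j) *D u) ∣         ≡⟨ cong (λ v → ∣ proj₁ ((μ j *D μ j) *D v) ∣) u≡-ε ⟩
      ∣ proj₁ ((μ j *D μ j) *D negate ε) ∣  ≡⟨ cong (λ z → ∣ proj₁ z ∣)
                                                (solve 2 (λ M ε → M :* (:- ε) := :- (M :* ε)) refl (μ j *D μ j) ε) ⟩
      ∣ - proj₁ ((μ j *D μ j) *D ε) ∣       ≡⟨ ℤP.∣-i∣≡∣i∣ (proj₁ ((μ j *D μ j) *D ε)) ⟩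
      ∣ proj₁ ((μ j *D μ j) *D ε) ∣         ∎

  n-shape : ∀ j → ∃[ h₁ ] ∃[ h₂ ] (n j ≡ (+ 4 * h₁ + + 2 , + 4 * h₂ + + 2) × j ℕ.< ∣ + 4 * h₁ + + 2 ∣)
  n-shape j =
    quotient w₁≡1 , quotient w₂≡1 ,
    trans n≡2w (trans (ι-*D (+ 2) w₁ w₂) (cong₂ _,_ (twice-odd w₁≡1) (twice-odd w₂≡1))) ,
    ℕP.<-≤-trans (w-grows j)
      (subst (∣ w₁ ∣ ℕ.≤_) (trans (sym (ℤP.abs-* (+ 2) w₁)) (cong ∣_∣ (twice-odd w₁≡1))) (ℕP.m≤n*m ∣ w₁ ∣ 2))
    where
    w₁ w₂ : ℤ
    w₁ = proj₁ (w j)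
    w₂ = proj₂ (w j)
    w-coordinates = norm≡-1⇒coordinates d w₁ w₂ d%4≡2 (trans (norm-*D (μ j *D μ j) u) (cong₂ _*_ (Nμ²≡1 j) Nu≡-1))
    w₁≡1 : w₁ ≡ + 1 mod 2
    w₁≡1 = odd-mod-4⇒odd (proj₁ w-coordinates)
    w₂≡1 : w₂ ≡ + 1 mod 2
    w₂≡1 = proj₂ w-coordinates
    n≡2w : n j ≡ ι (+ 2) *D w j
    n≡2w = solve 2 (λ M u → M :* (con (+ 2) :* u) := con (+ 2) :* (M :* u)) refl (μ j *D μ j) u

mainTheorem7 : (d : ℕ) → d % 4 ≡ 2 → SquareFree d →
    PellSolvable d (ℤ.- (+ 1)) → PellSolvable d (+ 6) →
    (L : List ZD) → ∃[ m ] ∃[ k ]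
    (((+ 4) * m + (+ 2) , (+ 4) * k + (+ 2)) ∉ L ×
    ¬ ZRing.DiffOfSquares d ((+ 4) * m + (+ 2) , (+ 4) * k + (+ 2)) ×
    ZRing.HasDQuadruple d ((+ 4) * m + (+ 2) , (+ 4) * k + (+ 2)))
mainTheorem7 d d%4≡2 _ (a , b , Nab≡-1) (x , y , Nξ≡6) L =
  h₁ , h₂ , ∉-by-size L bound<size ,
  subst (λ z → ¬ ZRing.DiffOfSquares d z) nⱼ≡ (n-not-difference-of-squares j) ,
  subst (ZRing.HasDQuadruple d) nⱼ≡ (n-has-DQuadruple j)
  where
  Nε≡-1 : norm d (+ ∣ a ∣ , + ∣ b ∣) ≡ - + 1
  Nε≡-1 = trans (cong₂ (λ p q → p - + d * q) (+∣z∣*+∣z∣≡z*z a) (+∣z∣*+∣z∣≡z*z b)) Nab≡-1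
  sign = normalised-sign d ∣ a ∣ ∣ b ∣ d%4≡2 Nε≡-1
  open Family d (norm≡-1⇒d%8≡2 d a b d%4≡2 Nab≡-1) Nε≡-1 {x , y} Nξ≡6 (proj₁ (proj₂ sign)) (proj₂ (proj₂ sign))
  j = bound L
  shape = n-shape j
  h₁ = proj₁ shape
  h₂ = proj₁ (proj₂ shape)
  nⱼ≡ = proj₁ (proj₂ (proj₂ shape))
  bound<size = proj₂ (proj₂ (proj₂ shape))
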